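{- Let $\rho:\Phi_t\rightarrow_\beta^*\Phi_{t'}$ be a reduction sequence of type derivations in system $\mathcal{V}$ (with subjects $t$ and $t'$), and let $p\in\mathrm{oc}(t)$. If some descendant $p'$ of $p$ after $\rho$ satisfies $p'\in\mathrm{toc}(\Phi_{t'})$, then $p\in\mathrm{toc}(\Phi_t)$.
   Context: Pure $\lambda$-terms; occurrences are words over $\{0,1\}$ ($0$: function part/abstraction body, $1$: argument). Descendants of $p$ after contracting $r$, $t|_r=(\lambda x.s)u$: $\emptyset$ if $p\in\{r,r0\}$; $\{p\}$ if $r$ is not a prefix of $p$; $\{rq\}$ if $p=r00q$; $\{rkq\mid s|_k=x\}$ if $p=r1q$; extended to sets by union and to sequences by iteration. System $\mathcal{V}$: types $\tau::=\mathtt{a}\mid\alpha\mid\mathcal{M}\to\tau$ ($\mathcal{M}$ finite multisets of types); rules (ax) $x:[\tau]\vdash x:\tau$; (val) $\emptyset\vdash\lambda x.t:\mathtt{a}$; ($\to$i) from $\Gamma\vdash t:\tau$ infer $\Gamma\setminus x\vdash\lambda x.t:\Gamma(x)\to\tau$; ($\to$e) from $\Gamma\vdash t:[\sigma_i]_{i\in I}\to\tau$ and $(\Delta_i\vdash u:\sigma_i)_{i\in I}$ infer $\Gamma+\sum_i\Delta_i\vdash t\,u:\tau$. Typed occurrences $\mathrm{toc}(\Phi)$: $\{\epsilon\}$ for (ax),(val); $\{\epsilon\}\cup0\cdot\mathrm{toc}(\Phi_t)$ for ($\to$i); $\{\epsilon\}\cup0\cdot\mathrm{toc}(\Phi_t)\cup\bigcup_i1\cdot\mathrm{toc}(\Phi_u^i)$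 for ($\to$e). Reduction of derivations: if $\Phi$ has subject $t$, $t\rightarrow_\beta t'$ by contracting redex occurrence $r$, and $m$ is the longest prefix of $r$ in $\mathrm{toc}(\Phi)$, then $\Phi\rightarrow_\beta\Phi'$ where every subderivation of $\Phi$ at $m$ is rewritten: if $m=r$ (typed redex), a subderivation ($\to$e) with left premise ($\to$i) on $\lambda x.s$ (premise $\Phi_s$) and argument premises $(\Phi_u^i)_{i\in I}$ is replaced by a typed substitution of $x$ by $(\Phi_u^i)$ in $\Phi_s$ (each axiom on $x$ replaced by a $\Phi_u^i$ of the same type, distributed nondeterministically, with $u$ substituted for $x$ in untyped parts); otherwise (redex inside an untyped argument or inside a (val) body) only the subject is reduced. -}

module Defs where

open import Data.Nat using (ℕ; zero; suc; _+_; _<_; _≤_)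
open import Data.Nat.Properties using (_≟_)
open import Data.Bool using (if_then_else_)
open import Data.List using (List; []; _∷_; _++_; concat; map)
open import Data.List.Relation.Unary.All using (All)
open import Data.List.Relation.Unary.Any using (Any)
open import Data.List.Relation.Binary.Pointwise using (Pointwise)
open import Data.List.Relation.Binary.Permutation.Propositional using (_↭_)
open import Data.Product using (Σ; ∃; _×_)
open import Relation.Nullary using (¬_; does)
open import Relation.Binary.PropositionalEquality using (_≡_)

-- Pure λ-terms (de Bruijn indices; `var n` refers to the n-th enclosing λ)

data Tm : Set where
  var : ℕ → Tm
  lam : Tm → Tm
  app : Tm → Tm → Tm

data Dir : Set where
  d0 d1 : Dir

Pos : Set
Pos = List Dir

data _∈oc_ : Pos → Tm → Set where
  here : ∀ {t} → [] ∈oc t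
  lam0 : ∀ {p t} → p ∈oc t → (d0 ∷ p) ∈oc lam t
  app0 : ∀ {p t u} → p ∈oc t → (d0 ∷ p) ∈oc app t u
  app1 : ∀ {p t u} → p ∈oc u → (d1 ∷ p) ∈oc app t u

data SubAt : Tm → Pos → Tm → Set where
  here : ∀ {t} → SubAt t [] t
  lam0 : ∀ {t p s} → SubAt t p s → SubAt (lam t) (d0 ∷ p) s
  app0 : ∀ {t u p s} → SubAt t p s → SubAt (app t u) (d0 ∷ p) s
  app1 : ∀ {t u p s} → SubAt u p s → SubAt (app t u) (d1 ∷ p) s

-- BoundOcc n s k : s|_k is the variable bound by a λ located n binders
-- above s (so BoundOcc 0 s k means s|_k = x for the body s of λx.s)
data BoundOcc : ℕ → Tm → Pos → Set where
  here : ∀ {n} → BoundOcc n (var n) []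
  lam0 : ∀ {n s k} → BoundOcc (suc n) s k → BoundOcc n (lam s) (d0 ∷ k)
  app0 : ∀ {n s v k} → BoundOcc n s k → BoundOcc n (app s v) (d0 ∷ k)
  app1 : ∀ {n s v k} → BoundOcc n v k → BoundOcc n (app s v) (d1 ∷ k)

ext : (ℕ → ℕ) → ℕ → ℕ
ext ρ zero    = zero
ext ρ (suc n) = suc (ρ n)

ren : (ℕ → ℕ) → Tm → Tm
ren ρ (var n)   = var (ρ n)
ren ρ (lam t)   = lam (ren (ext ρ) t)
ren ρ (app t u) = app (ren ρ t) (ren ρ u)

-- substAt n u t : substitute u (shifted by n) for the variable n in t,
-- decrementing the variables above n (substitution under n binders)
substVar : ℕ → Tm → ℕ → Tm
substVar zero    u zero    = u
substVar zero    u (suc y) = var y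
substVar (suc n) u zero    = var zero
substVar (suc n) u (suc y) = ren suc (substVar n u y)

substAt : ℕ → Tm → Tm → Tm
substAt n u (var y)   = substVar n u y
substAt n u (lam t)   = lam (substAt (suc n) u t)
substAt n u (app t v) = app (substAt n u t) (substAt n u v)

data Contract : Tm → Pos → Tm → Set where
  β    : ∀ {s u} → Contract (app (lam s) u) [] (substAt 0 u s)
  lam0 : ∀ {t r t'} → Contract t r t' → Contract (lam t) (d0 ∷ r) (lam t')
  app0 : ∀ {t u r t'} → Contract t r t' → Contract (app t u) (d0 ∷ r) (app t' u)
  app1 : ∀ {t u r u'} → Contract u r u' → Contract (app t u) (d1 ∷ r) (app t u')

data Desc (t : Tm) (r : Pos) : Pos → Pos → Set where
  outside : ∀ {p} → ¬ (∃ λ q → p ≡ r ++ q) → Desc t r p p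
  body    : ∀ {q} → Desc t r (r ++ d0 ∷ d0 ∷ q) (r ++ q)
  arg     : ∀ {s u k q} → SubAt t r (app (lam s) u) → BoundOcc 0 s k →
            Desc t r (r ++ d1 ∷ q) (r ++ k ++ q)

-- types: a | α (type variables indexed by ℕ) | M → τ, with multisets
-- represented by lists and identified up to the relation _≈M_ below
data Ty : Set where
  a    : Ty
  tv   : ℕ → Ty
  _⇒_  : List Ty → Ty → Ty

data _≈_ : Ty → Ty → Set
data _≈M_ : List Ty → List Ty → Set

data _≈_ where
  ≈a : a ≈ a
  ≈v : ∀ {n} → tv n ≈ tv n
  ≈⇒ : ∀ {M N τ σ} → M ≈M N → τ ≈ σ → (M ⇒ τ) ≈ (N ⇒ σ)

data _≈M_ where
  []  : [] ≈M []
  _∷_ : ∀ {τ σ M N₁ N₂} → τ ≈ σ → M ≈M (N₁ ++ N₂) → (τ ∷ M) ≈M (N₁ ++ σ ∷ N₂)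

-- (raw) derivation trees; the subject, type and contexts are computed
data D : Set where
  ax  : ℕ → Ty → D                -- (ax)   x:[τ] ⊢ x:τ
  val : Tm → D                    -- (val)  ⊢ λx.t : a   (stores the body t)
  lam : D → D
  app : D → Tm → List D → D       -- (→e)   function premise, argument u, argument premises

subj : D → Tm
subj (ax x τ)     = var x
subj (val t)      = lam t
subj (lam Φ)      = lam (subj Φ)
subj (app Φ u Φs) = app (subj Φ) u

-- Γ(x) : the multiset of types assigned to variable x by the context
ctxAt  : ℕ → D → List Ty
ctxAts : ℕ → List D → List Ty
ctxAt x (ax y τ)     = if does (x ≟ y) then τ ∷ [] else []
ctxAt x (val t)      = []
ctxAt x (lam Φ)      = ctxAt (suc x) Φ
ctxAt x (app Φ u Φs) = ctxAt x Φ ++ ctxAts x Φs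
ctxAts x []       = []
ctxAts x (Φ ∷ Φs) = ctxAt x Φ ++ ctxAts x Φs

cod : Ty → Ty
cod (M ⇒ τ) = τ
cod _       = a

ty : D → Ty
ty (ax x τ)     = τ
ty (val t)      = a
ty (lam Φ)      = ctxAt 0 Φ ⇒ ty Φ
ty (app Φ u Φs) = cod (ty Φ)

data Valid : D → Set where
  ax  : ∀ {x τ} → Valid (ax x τ)
  val : ∀ {t} → Valid (val t)
  lam : ∀ {Φ} → Valid Φ → Valid (lam Φ)
  app : ∀ {Φ u Φs σs τ} → Valid Φ → All Valid Φs → All (λ Ψ → subj Ψ ≡ u) Φs →
        ty Φ ≡ (σs ⇒ τ) → map ty Φs ≈M σs → Valid (app Φ u Φs)

data _∈toc_ : Pos → D → Set where
  here : ∀ {Φ} → [] ∈toc Φ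
  lam0 : ∀ {p Φ} → p ∈toc Φ → (d0 ∷ p) ∈toc lam Φ
  app0 : ∀ {p Φ u Φs} → p ∈toc Φ → (d0 ∷ p) ∈toc app Φ u Φs
  app1 : ∀ {p Φ u Φs} → Any (λ Ψ → p ∈toc Ψ) Φs → (d1 ∷ p) ∈toc app Φ u Φs

renD  : (ℕ → ℕ) → D → D
renDs : (ℕ → ℕ) → List D → List D
renD ρ (ax x τ)     = ax (ρ x) τ
renD ρ (val t)      = val (ren (ext ρ) t)
renD ρ (lam Φ)      = lam (renD (ext ρ) Φ)
renD ρ (app Φ u Φs) = app (renD ρ Φ) (ren ρ u) (renDs ρ Φs)
renDs ρ []       = []
renDs ρ (Φ ∷ Φs) = renD ρ Φ ∷ renDs ρ Φs

-- TSub n Φ u Ψs Φ' : Φ' is a typed substitution of the variable n (the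
-- variable x, seen under n binders) by the derivations Ψs (of u) in Φ;
-- each axiom on x is replaced by one of the Ψs of the same type, every
-- Ψ being used exactly once (nondeterministic distribution)
data TSub  : ℕ → D → Tm → List D → D → Set
data TSubs : ℕ → List D → Tm → List (List D) → List D → Set

data TSub where
  axx  : ∀ {n τ u Ψ} → ty Ψ ≈ τ → TSub n (ax n τ) u (Ψ ∷ []) (renD (n +_) Ψ)
  ax<  : ∀ {n y τ u} → y < n → TSub n (ax y τ) u [] (ax y τ)
  ax>  : ∀ {n y τ u} → n ≤ y → TSub n (ax (suc y) τ) u [] (ax y τ)
  val  : ∀ {n t u} → TSub n (val t) u [] (val (substAt (suc n) u t))
  lam  : ∀ {n Φ u Ψs Φ'} → TSub (suc n) Φ u Ψs Φ' → TSub n (lam Φ) u Ψs (lam Φ')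
  app  : ∀ {n Φ v Φs u Ψs Ψ₀ Ψss Φ' Φs'} →
         Ψs ↭ (Ψ₀ ++ concat Ψss) →
         TSub n Φ u Ψ₀ Φ' → TSubs n Φs u Ψss Φs' →
         TSub n (app Φ v Φs) u Ψs (app Φ' (substAt n u v) Φs')

data TSubs where
  []  : ∀ {n u} → TSubs n [] u [] []
  _∷_ : ∀ {n Φ Φs u Ψs Ψss Φ' Φs'} → TSub n Φ u Ψs Φ' → TSubs n Φs u Ψss Φs' →
        TSubs n (Φ ∷ Φs) u (Ψs ∷ Ψss) (Φ' ∷ Φs')

-- The rule descends along r through typed occurrences (so it stops at the
-- longest prefix m of r in toc(Φ)), rewriting every subderivation there.
data Step : D → Pos → D → Set where
  redex : ∀ {Φ u Ψs Φ'} → TSub 0 Φ u Ψs Φ' → Step (app (lam Φ) u Ψs) [] Φ'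
  lam0  : ∀ {Φ r Φ'} → Step Φ r Φ' → Step (lam Φ) (d0 ∷ r) (lam Φ')
  val0  : ∀ {t r t'} → Contract t r t' → Step (val t) (d0 ∷ r) (val t')
  app0  : ∀ {Φ u Φs r Φ'} → Step Φ r Φ' → Step (app Φ u Φs) (d0 ∷ r) (app Φ' u Φs)
  app1  : ∀ {Φ u Φs r u' Φs'} → Contract u r u' →
          Pointwise (λ Ψ Ψ' → Step Ψ r Ψ') Φs Φs' →
          Step (app Φ u Φs) (d1 ∷ r) (app Φ u' Φs')

data _⟶*_ : D → D → Set where
  []  : ∀ {Φ} → Φ ⟶* Φ
  _∷_ : ∀ {Φ r Φ₁ Φ₂} → Step Φ r Φ₁ → Φ₁ ⟶* Φ₂ → Φ ⟶* Φ₂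

DescSeq : ∀ {Φ Φ'} → Φ ⟶* Φ' → Pos → Pos → Set
DescSeq [] p p' = p ≡ p'
DescSeq (_∷_ {Φ} {r} s ρ) p p' = ∃ λ p₁ → Desc (subj Φ) r p p₁ × DescSeq ρ p₁ p'

-- One step of reduction is handled by following the step rule down the redex
-- path.  Off the redex, a typed position of the result sits in the same
-- subderivation, unchanged or reduced, of the original derivation.  At a
-- typed redex, the contractum was built by typed substitution: its typed
-- positions inside the body come from the body derivation, and those below an
-- occurrence of the bound variable come from an argument derivation that was
-- plugged in at a typed axiom, hence from a typed argument premise.  Since
-- the subject of the reduced derivation is the reduct of the subject and
-- descendants of occurrences are occurrences, this iterates along ρ.
module Submission where

open import Defs
open import Data.Nat using (zero; suc; _+_; _<_; _≤_; s≤s)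
open import Data.Nat.Properties using (n≮n)
open import Data.List using ([]; _∷_; _++_; concat)
open import Data.List.Relation.Unary.All using (All; []; _∷_)
open import Data.List.Relation.Unary.Any using (Any; here; there)
open import Data.List.Relation.Binary.Pointwise using (Pointwise; []; _∷_)
open import Data.List.Relation.Binary.Permutation.Propositional using (↭-sym)
open import Data.List.Relation.Binary.Permutation.Propositional.Properties using (All-resp-↭; Any-resp-↭)
import Data.List.Relation.Unary.All.Properties as All
import Data.List.Relation.Unary.Any.Properties as Any
open import Data.Product using (∃; _×_; _,_)
open import Data.Empty using (⊥-elim)
open import Function using (_∘_)
open import Relation.Binary.PropositionalEquality using (_≡_; refl; sym; trans; cong; cong₂; subst; module ≡-Reasoning)

ext-cong : ∀ {f g} → (∀ x → f x ≡ g x) → ∀ x → ext f x ≡ ext g x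
ext-cong e zero    = refl
ext-cong e (suc x) = cong suc (e x)

ext-id : ∀ {f} → (∀ x → f x ≡ x) → ∀ x → ext f x ≡ x
ext-id e zero    = refl
ext-id e (suc x) = cong suc (e x)

ext-∘ : ∀ f g x → ext f (ext g x) ≡ ext (f ∘ g) x
ext-∘ f g zero    = refl
ext-∘ f g (suc x) = refl

ren-cong : ∀ {f g} → (∀ x → f x ≡ g x) → ∀ t → ren f t ≡ ren g t
ren-cong e (var n)   = cong var (e n)
ren-cong e (lam t)   = cong lam (ren-cong (ext-cong e) t)
ren-cong e (app t u) = cong₂ app (ren-cong e t) (ren-cong e u)

ren-id : ∀ {f} → (∀ x → f x ≡ x) → ∀ t → ren f t ≡ t
ren-id e (var n)   = cong var (e n)
ren-id e (lam t)   = cong lam (ren-id (ext-id e) t)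
ren-id e (app t u) = cong₂ app (ren-id e t) (ren-id e u)

ren-∘ : ∀ f g t → ren f (ren g t) ≡ ren (f ∘ g) t
ren-∘ f g (var n)   = refl
ren-∘ f g (lam t)   = cong lam (trans (ren-∘ (ext f) (ext g) t) (ren-cong (ext-∘ f g) t))
ren-∘ f g (app t u) = cong₂ app (ren-∘ f g t) (ren-∘ f g u)

substVar-self : ∀ n u → substVar n u n ≡ ren (n +_) u
substVar-self zero    u = sym (ren-id (λ _ → refl) u)
substVar-self (suc n) u = begin
  ren suc (substVar n u n)  ≡⟨ cong (ren suc) (substVar-self n u) ⟩
  ren suc (ren (n +_) u)    ≡⟨ ren-∘ suc (n +_) u ⟩
  ren (suc n +_) u          ∎
  where open ≡-Reasoning

substVar-< : ∀ {n y} u → y < n → substVar n u y ≡ var y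
substVar-< {suc n} {zero}  u _         = refl
substVar-< {suc n} {suc y} u (s≤s y<n) = cong (ren suc) (substVar-< u y<n)

substVar-> : ∀ {n y} u → n ≤ y → substVar n u (suc y) ≡ var y
substVar-> {zero}          u _         = refl
substVar-> {suc n} {suc y} u (s≤s n≤y) = cong (ren suc) (substVar-> u n≤y)

-- The typing constraints of Valid are dropped: what the argument needs is
-- only that argument premises have the argument as subject, and that is
-- preserved by reduction without any subject-reduction property of types.
data Coherent : D → Set
CoherentArg : Tm → D → Set
CoherentArg u Ψ = Coherent Ψ × subj Ψ ≡ u

data Coherent where
  ax  : ∀ {x τ} → Coherent (ax x τ)
  val : ∀ {t} → Coherent (val t)
  lam : ∀ {Φ} → Coherent Φ → Coherent (lam Φ)
  app : ∀ {Φ u Φs} → Coherent Φ → All (CoherentArg u) Φs → Coherent (app Φ u Φs)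

valid⇒coherent     : ∀ {Φ} → Valid Φ → Coherent Φ
valid⇒coherentArgs : ∀ {u Φs} → All Valid Φs → All (λ Ψ → subj Ψ ≡ u) Φs →
                     All (CoherentArg u) Φs
valid⇒coherent ax                = ax
valid⇒coherent val               = val
valid⇒coherent (lam v)           = lam (valid⇒coherent v)
valid⇒coherent (app v vs es _ _) = app (valid⇒coherent v) (valid⇒coherentArgs vs es)
valid⇒coherentArgs []       []       = []
valid⇒coherentArgs (v ∷ vs) (e ∷ es) = (valid⇒coherent v , e) ∷ valid⇒coherentArgs vs es

subj-renD : ∀ ρ Ψ → subj (renD ρ Ψ) ≡ ren ρ (subj Ψ)
subj-renD ρ (ax x τ)     = refl
subj-renD ρ (val t)      = refl
subj-renD ρ (lam Ψ)      = cong lam (subj-renD (ext ρ) Ψ)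
subj-renD ρ (app Ψ u Ψs) = cong (λ z → app z (ren ρ u)) (subj-renD ρ Ψ)

coherent-renD     : ∀ ρ {Ψ} → Coherent Ψ → Coherent (renD ρ Ψ)
coherentArgs-renD : ∀ ρ {u Ψs} → All (CoherentArg u) Ψs →
                    All (CoherentArg (ren ρ u)) (renDs ρ Ψs)
coherent-renD ρ ax           = ax
coherent-renD ρ val          = val
coherent-renD ρ (lam w)      = lam (coherent-renD (ext ρ) w)
coherent-renD ρ (app w args) = app (coherent-renD ρ w) (coherentArgs-renD ρ args)
coherentArgs-renD ρ []                              = []
coherentArgs-renD ρ {Ψs = Ψ ∷ _} ((w , refl) ∷ args) =
  (coherent-renD ρ w , subj-renD ρ Ψ) ∷ coherentArgs-renD ρ args

∈toc-renD⁻  : ∀ ρ Ψ {q} → q ∈toc renD ρ Ψ → q ∈toc Ψ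
∈toc-renDs⁻ : ∀ ρ Ψs {q} → Any (q ∈toc_) (renDs ρ Ψs) → Any (q ∈toc_) Ψs
∈toc-renD⁻ ρ (ax x τ)     here     = here
∈toc-renD⁻ ρ (val t)      here     = here
∈toc-renD⁻ ρ (lam Ψ)      here     = here
∈toc-renD⁻ ρ (app Ψ u Ψs) here     = here
∈toc-renD⁻ ρ (lam Ψ)      (lam0 h) = lam0 (∈toc-renD⁻ (ext ρ) Ψ h)
∈toc-renD⁻ ρ (app Ψ u Ψs) (app0 h) = app0 (∈toc-renD⁻ ρ Ψ h)
∈toc-renD⁻ ρ (app Ψ u Ψs) (app1 h) = app1 (∈toc-renDs⁻ ρ Ψs h)
∈toc-renDs⁻ ρ (Ψ ∷ Ψs) (here h)  = here (∈toc-renD⁻ ρ Ψ h)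
∈toc-renDs⁻ ρ (Ψ ∷ Ψs) (there h) = there (∈toc-renDs⁻ ρ Ψs h)

tsub-coherent  : ∀ {n Φ u Ψs Φ'} → TSub n Φ u Ψs Φ' → Coherent Φ →
                 All (CoherentArg u) Ψs → CoherentArg (substAt n u (subj Φ)) Φ'
tsubs-coherent : ∀ {n Φs u v Ψss Φs'} → TSubs n Φs u Ψss Φs' → All (CoherentArg v) Φs →
                 All (All (CoherentArg u)) Ψss → All (CoherentArg (substAt n u v)) Φs'
tsub-coherent {n} (axx {Ψ = Ψ} _) ax ((w , refl) ∷ []) =
  coherent-renD (n +_) w , trans (subj-renD (n +_) Ψ) (sym (substVar-self n (subj Ψ)))
tsub-coherent {u = u} (ax< y<n) ax [] = ax , sym (substVar-< u y<n)
tsub-coherent {u = u} (ax> n≤y) ax [] = ax , sym (substVar-> u n≤y)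
tsub-coherent val val [] = val , refl
tsub-coherent (lam ts) (lam w) args =
  let w' , e = tsub-coherent ts w args in lam w' , cong lam e
tsub-coherent (app {Ψ₀ = Ψ₀} perm ts tss) (app w ws) args =
  let args₀ , argss = All.++⁻ Ψ₀ (All-resp-↭ perm args)
      w' , e        = tsub-coherent ts w args₀
  in app w' (tsubs-coherent tss ws (All.concat⁻ argss)) , cong (λ z → app z _) e
tsubs-coherent []         []               []             = []
tsubs-coherent (ts ∷ tss) ((w , refl) ∷ ws) (args ∷ argss) =
  tsub-coherent ts w args ∷ tsubs-coherent tss ws argss

contract-deterministic : ∀ {t r t₁ t₂} → Contract t r t₁ → Contract t r t₂ → t₁ ≡ t₂
contract-deterministic β        β        = refl
contract-deterministic (lam0 c) (lam0 d) = cong lam (contract-deterministic c d)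
contract-deterministic (app0 c) (app0 d) = cong (λ z → app z _) (contract-deterministic c d)
contract-deterministic (app1 c) (app1 d) = cong (app _) (contract-deterministic c d)

step-coherent     : ∀ {Φ r Φ₁} → Step Φ r Φ₁ → Coherent Φ →
                    Contract (subj Φ) r (subj Φ₁) × Coherent Φ₁
argSteps-coherent : ∀ {u r u' Φs Φs'} → Contract u r u' →
                    Pointwise (λ Ψ Ψ' → Step Ψ r Ψ') Φs Φs' →
                    All (CoherentArg u) Φs → All (CoherentArg u') Φs'
step-coherent (redex ts) (app (lam w) args) =
  let w' , e = tsub-coherent ts w args in subst (Contract _ []) (sym e) β , w'
step-coherent (lam0 s) (lam w) =
  let c , w' = step-coherent s w in lam0 c , lam w'
step-coherent (val0 c) val = lam0 c , val
step-coherent (app0 s) (app w args) =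
  let c , w' = step-coherent s w in app0 c , app w' args
step-coherent (app1 c ss) (app w args) = app1 c , app w (argSteps-coherent c ss args)
argSteps-coherent c []       []                 = []
argSteps-coherent c (s ∷ ss) ((w , refl) ∷ args) =
  let c' , w' = step-coherent s w
  in (w' , sym (contract-deterministic c c')) ∷ argSteps-coherent c ss args

-- Desc unfolded along the redex path, in the shape of Contract and Step.  The
-- constructor lam1 only relates positions d1 ∷ p below a λ, which are not
-- occurrences; it makes desc⇒descends total.
data Descends : Tm → Pos → Pos → Pos → Set where
  body   : ∀ {s u q} → Descends (app (lam s) u) [] (d0 ∷ d0 ∷ q) q
  arg    : ∀ {s u k q} → BoundOcc 0 s k → Descends (app (lam s) u) [] (d1 ∷ q) (k ++ q)
  root   : ∀ {t d r} → Descends t (d ∷ r) [] []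
  lam0   : ∀ {t r p p₁} → Descends t r p p₁ → Descends (lam t) (d0 ∷ r) (d0 ∷ p) (d0 ∷ p₁)
  lam1   : ∀ {t r p} → Descends (lam t) (d0 ∷ r) (d1 ∷ p) (d1 ∷ p)
  app0   : ∀ {t u r p p₁} → Descends t r p p₁ → Descends (app t u) (d0 ∷ r) (d0 ∷ p) (d0 ∷ p₁)
  app0-1 : ∀ {t u r p} → Descends (app t u) (d0 ∷ r) (d1 ∷ p) (d1 ∷ p)
  app1   : ∀ {t u r p p₁} → Descends u r p p₁ → Descends (app t u) (d1 ∷ r) (d1 ∷ p) (d1 ∷ p₁)
  app1-0 : ∀ {t u r p} → Descends (app t u) (d1 ∷ r) (d0 ∷ p) (d0 ∷ p)

∷-prefix : ∀ {d p r} → ∃ (λ (q : Pos) → p ≡ r ++ q) → ∃ (λ (q : Pos) → d ∷ p ≡ (d ∷ r) ++ q)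
∷-prefix {d} (q , p≡rq) = q , cong (d ∷_) p≡rq

desc⇒descends : ∀ {t r t' p p₁} → Contract t r t' → Desc t r p p₁ → Descends t r p p₁
desc⇒descends β        (outside {p} r∤p)       = ⊥-elim (r∤p (p , refl))
desc⇒descends β        body                    = body
desc⇒descends β        (arg here x∈s)          = arg x∈s
desc⇒descends (lam0 c) (outside {[]} _)        = root
desc⇒descends (lam0 c) (outside {d0 ∷ _} r∤p)  = lam0 (desc⇒descends c (outside (r∤p ∘ ∷-prefix)))
desc⇒descends (lam0 c) (outside {d1 ∷ _} _)    = lam1
desc⇒descends (lam0 c) body                    = lam0 (desc⇒descends c body)
desc⇒descends (lam0 c) (arg (lam0 r∈t) x∈s)    = lam0 (desc⇒descends c (arg r∈t x∈s))
desc⇒descends (app0 c) (outside {[]} _)        = root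
desc⇒descends (app0 c) (outside {d0 ∷ _} r∤p)  = app0 (desc⇒descends c (outside (r∤p ∘ ∷-prefix)))
desc⇒descends (app0 c) (outside {d1 ∷ _} _)    = app0-1
desc⇒descends (app0 c) body                    = app0 (desc⇒descends c body)
desc⇒descends (app0 c) (arg (app0 r∈t) x∈s)    = app0 (desc⇒descends c (arg r∈t x∈s))
desc⇒descends (app1 c) (outside {[]} _)        = root
desc⇒descends (app1 c) (outside {d0 ∷ _} _)    = app1-0
desc⇒descends (app1 c) (outside {d1 ∷ _} r∤p)  = app1 (desc⇒descends c (outside (r∤p ∘ ∷-prefix)))
desc⇒descends (app1 c) body                    = app1 (desc⇒descends c body)
desc⇒descends (app1 c) (arg (app1 r∈u) x∈s)    = app1 (desc⇒descends c (arg r∈u x∈s))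

∈oc-ren⁺ : ∀ {q} ρ t → q ∈oc t → q ∈oc ren ρ t
∈oc-ren⁺ ρ t         here     = here
∈oc-ren⁺ ρ (lam t)   (lam0 o) = lam0 (∈oc-ren⁺ (ext ρ) t o)
∈oc-ren⁺ ρ (app t u) (app0 o) = app0 (∈oc-ren⁺ ρ t o)
∈oc-ren⁺ ρ (app t u) (app1 o) = app1 (∈oc-ren⁺ ρ u o)

∈oc-substAt⁺ : ∀ {q} n u s → q ∈oc s → q ∈oc substAt n u s
∈oc-substAt⁺ n u s         here     = here
∈oc-substAt⁺ n u (lam s)   (lam0 o) = lam0 (∈oc-substAt⁺ (suc n) u s o)
∈oc-substAt⁺ n u (app s v) (app0 o) = app0 (∈oc-substAt⁺ n u s o)
∈oc-substAt⁺ n u (app s v) (app1 o) = app1 (∈oc-substAt⁺ n u v o)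

∈oc-substAt-bound⁺ : ∀ {n s k q} u → BoundOcc n s k → q ∈oc u → (k ++ q) ∈oc substAt n u s
∈oc-substAt-bound⁺ {n} u here     o = subst (_ ∈oc_) (sym (substVar-self n u)) (∈oc-ren⁺ (n +_) u o)
∈oc-substAt-bound⁺     u (lam0 b) o = lam0 (∈oc-substAt-bound⁺ u b o)
∈oc-substAt-bound⁺     u (app0 b) o = app0 (∈oc-substAt-bound⁺ u b o)
∈oc-substAt-bound⁺     u (app1 b) o = app1 (∈oc-substAt-bound⁺ u b o)

∈oc-descends⁺ : ∀ {t r t' p p₁} → Contract t r t' → Descends t r p p₁ → p ∈oc t → p₁ ∈oc t'
∈oc-descends⁺ (β {s} {u}) body     (app0 (lam0 o)) = ∈oc-substAt⁺ 0 u s o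
∈oc-descends⁺ (β {s} {u}) (arg b)  (app1 o)        = ∈oc-substAt-bound⁺ u b o
∈oc-descends⁺ c           root     o               = here
∈oc-descends⁺ (lam0 c)    (lam0 d) (lam0 o)        = lam0 (∈oc-descends⁺ c d o)
∈oc-descends⁺ (lam0 c)    lam1     ()
∈oc-descends⁺ (app0 c)    (app0 d) (app0 o)        = app0 (∈oc-descends⁺ c d o)
∈oc-descends⁺ (app0 c)    app0-1   (app1 o)        = app1 o
∈oc-descends⁺ (app1 c)    (app1 d) (app1 o)        = app1 (∈oc-descends⁺ c d o)
∈oc-descends⁺ (app1 c)    app1-0   (app0 o)        = app0 o

-- Without q ∈oc subj Φ this fails: a typed position inside an argument
-- derivation plugged in for x is not a position of the axiom it replaced.
∈toc-tsub⁻  : ∀ {n Φ u Ψs Φ' q} → TSub n Φ u Ψs Φ' → Coherent Φ →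
              q ∈oc subj Φ → q ∈toc Φ' → q ∈toc Φ
∈toc-tsubs⁻ : ∀ {n Φs u v Ψss Φs' q} → TSubs n Φs u Ψss Φs' → All (CoherentArg v) Φs →
              q ∈oc v → Any (q ∈toc_) Φs' → Any (q ∈toc_) Φs
∈toc-tsub⁻ (axx _)         _            here     _        = here
∈toc-tsub⁻ (ax< _)         _            here     _        = here
∈toc-tsub⁻ (ax> _)         _            here     _        = here
∈toc-tsub⁻ val             _            _        here     = here
∈toc-tsub⁻ (lam ts)        _            _        here     = here
∈toc-tsub⁻ (lam ts)        (lam w)      (lam0 o) (lam0 h) = lam0 (∈toc-tsub⁻ ts w o h)
∈toc-tsub⁻ (app _ ts tss)  _            _        here     = here
∈toc-tsub⁻ (app _ ts tss)  (app w args) (app0 o) (app0 h) = app0 (∈toc-tsub⁻ ts w o h)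
∈toc-tsub⁻ (app _ ts tss)  (app w args) (app1 o) (app1 h) = app1 (∈toc-tsubs⁻ tss args o h)
∈toc-tsubs⁻ (ts ∷ tss) ((w , refl) ∷ args) o (here h)  = here (∈toc-tsub⁻ ts w o h)
∈toc-tsubs⁻ (ts ∷ tss) ((w , refl) ∷ args) o (there h) = there (∈toc-tsubs⁻ tss args o h)

∈toc-tsub-bound⁻  : ∀ {n Φ u Ψs Φ' k q} → TSub n Φ u Ψs Φ' → Coherent Φ →
                    BoundOcc n (subj Φ) k → (k ++ q) ∈toc Φ' → Any (q ∈toc_) Ψs
∈toc-tsubs-bound⁻ : ∀ {n Φs u v Ψss Φs' k q} → TSubs n Φs u Ψss Φs' →
                    All (CoherentArg v) Φs → BoundOcc n v k →
                    Any ((k ++ q) ∈toc_) Φs' → Any (q ∈toc_) (concat Ψss)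
∈toc-tsub-bound⁻ {n} (axx {Ψ = Ψ} _) _ here h = here (∈toc-renD⁻ (n +_) Ψ h)
∈toc-tsub-bound⁻ (ax< n<n) _ here _ = ⊥-elim (n≮n _ n<n)
∈toc-tsub-bound⁻ (ax> n<n) _ here _ = ⊥-elim (n≮n _ n<n)
∈toc-tsub-bound⁻ val _ (lam0 b) ()
∈toc-tsub-bound⁻ (lam ts) (lam w) (lam0 b) (lam0 h) = ∈toc-tsub-bound⁻ ts w b h
∈toc-tsub-bound⁻ (app perm ts tss) (app w args) (app0 b) (app0 h) =
  Any-resp-↭ (↭-sym perm) (Any.++⁺ˡ (∈toc-tsub-bound⁻ ts w b h))
∈toc-tsub-bound⁻ (app {Ψ₀ = Ψ₀} perm ts tss) (app w args) (app1 b) (app1 h) =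
  Any-resp-↭ (↭-sym perm) (Any.++⁺ʳ Ψ₀ (∈toc-tsubs-bound⁻ tss args b h))
∈toc-tsubs-bound⁻ (ts ∷ tss) ((w , refl) ∷ args) b (here h) =
  Any.++⁺ˡ (∈toc-tsub-bound⁻ ts w b h)
∈toc-tsubs-bound⁻ (_∷_ {Ψs = Ψs} ts tss) ((w , refl) ∷ args) b (there h) =
  Any.++⁺ʳ Ψs (∈toc-tsubs-bound⁻ tss args b h)

∈toc-step⁻     : ∀ {Φ r Φ₁ p p₁} → Step Φ r Φ₁ → Coherent Φ → Descends (subj Φ) r p p₁ →
                 p ∈oc subj Φ → p₁ ∈toc Φ₁ → p ∈toc Φ
∈toc-argSteps⁻ : ∀ {u r Φs Φs' p p₁} → Pointwise (λ Ψ Ψ' → Step Ψ r Ψ') Φs Φs' →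
                 All (CoherentArg u) Φs → Descends u r p p₁ → p ∈oc u →
                 Any (p₁ ∈toc_) Φs' → Any (p ∈toc_) Φs
∈toc-step⁻ (redex ts) (app (lam w) _)  body     (app0 (lam0 o)) h = app0 (lam0 (∈toc-tsub⁻ ts w o h))
∈toc-step⁻ (redex ts) (app (lam w) _)  (arg b)  _               h = app1 (∈toc-tsub-bound⁻ ts w b h)
∈toc-step⁻ (lam0 s)   _                root     _ _ = here
∈toc-step⁻ (val0 c)   _                root     _ _ = here
∈toc-step⁻ (app0 s)   _                root     _ _ = here
∈toc-step⁻ (app1 c _) _                root     _ _ = here
∈toc-step⁻ (lam0 s)   (lam w)          (lam0 d) (lam0 o) (lam0 h) = lam0 (∈toc-step⁻ s w d o h)
∈toc-step⁻ (lam0 s)   _                lam1     ()       _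
∈toc-step⁻ (val0 c)   _                (lam0 d) _        ()
∈toc-step⁻ (val0 c)   _                lam1     ()       _
∈toc-step⁻ (app0 s)   (app w _)        (app0 d) (app0 o) (app0 h) = app0 (∈toc-step⁻ s w d o h)
∈toc-step⁻ (app0 s)   _                app0-1   _        (app1 h) = app1 h
∈toc-step⁻ (app1 c ss) (app _ args)    (app1 d) (app1 o) (app1 h) = app1 (∈toc-argSteps⁻ ss args d o h)
∈toc-step⁻ (app1 c ss) _               app1-0   _        (app0 h) = app0 h
∈toc-argSteps⁻ (s ∷ ss) ((w , refl) ∷ args) d o (here h)  = here (∈toc-step⁻ s w d o h)
∈toc-argSteps⁻ (s ∷ ss) ((w , refl) ∷ args) d o (there h) = there (∈toc-argSteps⁻ ss args d o h)

∈toc-reduction⁻ : ∀ {Φ Φ'} (ρ : Φ ⟶* Φ') → Coherent Φ →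
                  ∀ {p p'} → p ∈oc subj Φ → DescSeq ρ p p' → p' ∈toc Φ' → p ∈toc Φ
∈toc-reduction⁻ []      w o refl           h = h
∈toc-reduction⁻ (s ∷ ρ) w o (_ , d , ds) h =
  let c , w₁ = step-coherent s w
      d′     = desc⇒descends c d
  in ∈toc-step⁻ s w d′ o (∈toc-reduction⁻ ρ w₁ (∈oc-descends⁺ c d′ o) ds h)

mainTheorem11 : ∀ {Φ Φ'} (ρ : Φ ⟶* Φ') → Valid Φ →
                ∀ {p p'} → p ∈oc subj Φ → DescSeq ρ p p' → p' ∈toc Φ' →
                p ∈toc Φ
mainTheorem11 ρ valid = ∈toc-reduction⁻ ρ (valid⇒coherent valid)
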